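{- Let $k\ge3$ and let $i,n$ be nonnegative integers with $i<n$ and $n\geq k+1$. Then $W^{(k)}_n$ contains no factor of the form $W^{(k)}_iW^{(k)}_i$.
   Context: Words are over $\mathbb{N}$. Define the morphism $\varphi_k$ by $\varphi_k(ki+j)=(ki)(ki+j+1)$ if $0\le j\le k-2$ and $\varphi_k(ki+j)=(ki+j+1)$ if $j=k-1$; let $W^{(k)}_n=\varphi_k^n(0)$. -}

module Defs where

open import Data.Nat using (ℕ; zero; suc; _+_; _*_; _∸_; NonZero)
open import Data.Nat.DivMod using (_/_; _%_)
open import Data.List using (List; []; _∷_; _++_; concatMap)
open import Data.Product using (∃-syntax; _×_)
open import Relation.Binary.PropositionalEquality using (_≡_)
open import Relation.Nullary using (¬_)
open import Data.Bool using (if_then_else_)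
open import Data.Nat using (_≡ᵇ_)

Word : Set
Word = List ℕ

φ-letter : (k : ℕ) → .{{_ : NonZero k}} → ℕ → Word
φ-letter k m =
  if (m % k) ≡ᵇ (k ∸ 1)
  then (m + 1) ∷ []
  else (k * (m / k)) ∷ (m + 1) ∷ []

φ : (k : ℕ) → .{{_ : NonZero k}} → Word → Word
φ k w = concatMap (φ-letter k) w

φ^ : (k : ℕ) → .{{_ : NonZero k}} → ℕ → Word → Word
φ^ k zero    w = w
φ^ k (suc n) w = φ k (φ^ k n w)

W : (k : ℕ) → .{{_ : NonZero k}} → ℕ → Word
W k n = φ^ k n (0 ∷ [])

IsFactor : Word → Word → Set
IsFactor x w = ∃[ u ] ∃[ v ] (w ≡ u ++ x ++ v)

-- In φ_k(w) the multiples of k are exactly the first letters of the blocks φ_k(m), m ∈ w, and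
-- the letter in front of such a block boundary is the last letter m + 1 of the preceding block.
-- So an occurrence of c φ_k(x) a … in W_{n+1}, with k ∣ a, is the image of an occurrence of
-- (c - 1) x … in W_n; desubstituting all the way down ends at W_0 = 0, which has no factor of
-- length two.
-- Writing W_l = I_l l (I_l is W-init l), induction on l along these preimages shows that c W_l
-- never occurs for c ≤ l; along the way c I_l (for l ≥ k - 1) and c I_l e (for c, e ≤ l < k)
-- are ruled out. As W_i W_i contains i W_i, the theorem follows.
module Submission where

open import Defs
open import Data.Bool using (true; false; if_then_else_; T)
open import Data.Empty using (⊥-elim)
open import Data.List using ([]; _∷_; _++_; [_])
open import Data.List.Properties
  using (++-assoc; ++-identityʳ; ++-conicalˡ; ++-conicalʳ;
         ∷-injective; ∷-injectiveˡ; ∷-injectiveʳ; ∷ʳ-injective; ∷ʳ-++; concatMap-++)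
open import Data.List.Reverse using ([]; _∶_∶ʳ_; reverseView)
open import Data.Nat
  using (ℕ; zero; suc; _+_; _*_; _∸_; _≤_; _<_; _≤?_; NonZero; _≡ᵇ_; z≤n; s≤s; s≤s⁻¹)
open import Data.Nat.DivMod
open import Data.Nat.Properties
open import Data.Product using (∃-syntax; _×_; _,_; proj₂)
open import Data.Sum using (_⊎_; inj₁; inj₂)
open import Data.Unit using (⊤)
open import Function using (_∘_)
open import Relation.Nullary using (¬_; yes; no)
open import Relation.Binary.PropositionalEquality hiding ([_])

module _ (k : ℕ) .{{_ : NonZero k}} where

  0%k≡0 : 0 % k ≡ 0
  0%k≡0 = m*n%n≡0 0 k

  k*q%k≡0 : ∀ q → k * q % k ≡ 0
  k*q%k≡0 q = trans (cong (_% k) (*-comm k q)) (m*n%n≡0 q k)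

  last⇒suc%k≡0 : ∀ {m} → m % k ≡ k ∸ 1 → suc m % k ≡ 0
  last⇒suc%k≡0 {m} m-last = begin
    suc m % k                     ≡⟨ cong (λ x → suc x % k) (m≡m%n+[m/n]*n m k) ⟩
    (suc (m % k) + m / k * k) % k ≡⟨ cong (λ r → (suc r + m / k * k) % k) m-last ⟩
    (suc (k ∸ 1) + m / k * k) % k ≡⟨ cong (λ x → (x + m / k * k) % k) (suc-pred k) ⟩
    (k + m / k * k) % k           ≡⟨ [m+kn]%n≡m%n k (m / k) k ⟩
    k % k                         ≡⟨ n%n≡0 k ⟩
    0                             ∎
    where open ≡-Reasoning

  long⇒suc%k≢0 : ∀ {m} → m % k ≢ k ∸ 1 → suc m % k ≢ 0
  long⇒suc%k≢0 m-long = m-long ∘ %-pred-≡0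

  last⇒k≤suc : ∀ {m} → m % k ≡ k ∸ 1 → k ≤ suc m
  last⇒k≤suc {m} m-last = begin
    k              ≡⟨ suc-pred k ⟨
    suc (k ∸ 1)    ≡⟨ cong suc m-last ⟨
    suc (m % k)    ≤⟨ s≤s (m%n≤m m k) ⟩
    suc m          ∎
    where open ≤-Reasoning

  aligned⇒not-last : 1 < k → ∀ {a} → a % k ≡ 0 → a % k ≢ k ∸ 1
  aligned⇒not-last 1<k a-aligned a-last = m>n⇒m∸n≢0 1<k (trans (sym a-last) a-aligned)

  φ-init : ℕ → Word
  φ-init m = if m % k ≡ᵇ k ∸ 1 then [] else [ k * (m / k) ]

  φ-letter≡ : ∀ m → φ-letter k m ≡ φ-init m ++ [ suc m ]
  φ-letter≡ m = by-residue (m % k ≡ᵇ k ∸ 1)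
    where
    by-residue : ∀ b → (if b then [ m + 1 ] else k * (m / k) ∷ [ m + 1 ])
                     ≡ (if b then [] else [ k * (m / k) ]) ++ [ suc m ]
    by-residue true  = cong [_] (+-comm m 1)
    by-residue false = cong (λ x → k * (m / k) ∷ [ x ]) (+-comm m 1)

  data Shape (m : ℕ) : Set where
    short : m % k ≡ k ∸ 1 → φ-init m ≡ []              → Shape m
    long  : m % k ≢ k ∸ 1 → φ-init m ≡ [ k * (m / k) ] → Shape m

  shape : ∀ m → Shape m
  shape m with m % k ≡ᵇ k ∸ 1 in eq
  ... | true  = short (≡ᵇ⇒≡ _ _ (subst T (sym eq) _)) (cong (if_then [] else [ k * (m / k) ]) eq)
  ... | false = long (λ p → subst T eq (≡⇒≡ᵇ _ _ p)) (cong (if_then [] else [ k * (m / k) ]) eq)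

  φ-letter-init : ∀ {m ι} → φ-init m ≡ ι → φ-letter k m ≡ ι ++ [ suc m ]
  φ-letter-init {m} e = trans (φ-letter≡ m) (cong (_++ [ suc m ]) e)

  φ-letter-long : ∀ {m} → m % k ≢ k ∸ 1 → φ-letter k m ≡ k * (m / k) ∷ [ suc m ]
  φ-letter-long {m} m-long with shape m
  ... | short m-last _ = ⊥-elim (m-long m-last)
  ... | long _ e       = φ-letter-init e

  φ-letter≢[] : ∀ m → φ-letter k m ≢ []
  φ-letter≢[] m eq with () ← ++-conicalʳ (φ-init m) [ suc m ] (trans (sym (φ-letter≡ m)) eq)

  φ-++ : ∀ x y → φ k (x ++ y) ≡ φ k x ++ φ k y
  φ-++ = concatMap-++ (φ-letter k)

  -- A suffix s of φ_k(w) is aligned exactly when it starts at a block boundary.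
  Aligned : Word → Set
  Aligned []      = ⊤
  Aligned (a ∷ _) = a % k ≡ 0

  φ-letter-aligned : ∀ m s → Aligned (φ-letter k m ++ s)
  φ-letter-aligned m s with shape m
  ... | short m-last e = subst Aligned (cong (_++ s) (sym (φ-letter-init e))) (last⇒suc%k≡0 m-last)
  ... | long  _      e = subst Aligned (cong (_++ s) (sym (φ-letter-init e))) (k*q%k≡0 (m / k))

  φ-aligned : ∀ w → Aligned (φ k w)
  φ-aligned []      = _
  φ-aligned (m ∷ w) = φ-letter-aligned m (φ k w)

  φ-++-aligned : ∀ x {s} → Aligned s → Aligned (φ k x ++ s)
  φ-++-aligned []      s-aligned = s-aligned
  φ-++-aligned (m ∷ x) {s} _     =
    subst Aligned (sym (++-assoc (φ-letter k m) (φ k x) s)) (φ-letter-aligned m _)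

  φ-letter-cancel : ∀ {m m' A B} → Aligned A → Aligned B ⊎ m % k ≢ k ∸ 1 →
                    φ-letter k m' ++ A ≡ φ-letter k m ++ B → m' ≡ m × A ≡ B
  φ-letter-cancel {m} {m'} {A} {B} A-aligned B-aligned-or-long eq =
    cancel (shape m') (shape m) B-aligned-or-long
    where
    unfolded : ∀ {ι' ι} → φ-init m' ≡ ι' → φ-init m ≡ ι →
               (ι' ++ [ suc m' ]) ++ A ≡ (ι ++ [ suc m ]) ++ B
    unfolded e' e =
      trans (cong (_++ A) (sym (φ-letter-init e'))) (trans eq (cong (_++ B) (φ-letter-init e)))

    cancel : Shape m' → Shape m → Aligned B ⊎ m % k ≢ k ∸ 1 → m' ≡ m × A ≡ B
    cancel (short _ e') (short _ e) _ with eq' ← unfolded e' e =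
      suc-injective (∷-injectiveˡ eq') , ∷-injectiveʳ eq'
    cancel (long _ e') (long _ e) _ with eq' ← ∷-injectiveʳ (unfolded e' e) =
      suc-injective (∷-injectiveˡ eq') , ∷-injectiveʳ eq'
    cancel (short _ e') (long m-long e) _ =
      ⊥-elim (long⇒suc%k≢0 m-long (subst Aligned (∷-injectiveʳ (unfolded e' e)) A-aligned))
    cancel (long m'-long e') (short _ e) (inj₁ B-aligned) =
      ⊥-elim (long⇒suc%k≢0 m'-long (subst Aligned (sym (∷-injectiveʳ (unfolded e' e))) B-aligned))
    cancel (long _ _) (short m-last _) (inj₂ m-long) = ⊥-elim (m-long m-last)

  φ-injective : ∀ x y → φ k x ≡ φ k y → x ≡ y
  φ-injective []      []       _  = refl
  φ-injective []      (m ∷ y)  eq = ⊥-elim (φ-letter≢[] m (++-conicalˡ _ _ (sym eq)))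
  φ-injective (m ∷ x) []       eq = ⊥-elim (φ-letter≢[] m (++-conicalˡ _ _ eq))
  φ-injective (m ∷ x) (m' ∷ y) eq
    with refl , φx≡φy ← φ-letter-cancel (φ-aligned x) (inj₁ (φ-aligned y)) eq =
    cong (m ∷_) (φ-injective x y φx≡φy)

  φ-long-prefix : ∀ {m} → m % k ≢ k ∸ 1 → ∀ t {v} → φ k t ≡ φ-letter k m ++ v →
                  ∃[ t' ] t ≡ m ∷ t'
  φ-long-prefix {m} _ [] eq = ⊥-elim (φ-letter≢[] m (++-conicalˡ _ _ (sym eq)))
  φ-long-prefix m-long (m' ∷ t') eq
    with refl , _ ← φ-letter-cancel (φ-aligned t') (inj₂ m-long) eq = t' , refl

  φ-from-0 : ∀ t {s} → φ k t ≡ 0 ∷ s →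
             ∃[ f ] ∃[ t' ] t ≡ f ∷ t' × s ≡ suc f ∷ φ k t' × suc f < k
  φ-from-0 []       ()
  φ-from-0 (f ∷ t') {s} eq = f , t' , refl , by-shape (shape f)
    where
    unfolded : ∀ {ι} → φ-init f ≡ ι → (ι ++ [ suc f ]) ++ φ k t' ≡ 0 ∷ s
    unfolded e = trans (cong (_++ φ k t') (sym (φ-letter-init e))) eq

    by-shape : Shape f → s ≡ suc f ∷ φ k t' × suc f < k
    by-shape (short _ e) with () ← ∷-injectiveˡ (unfolded e)
    by-shape (long f-long e) with kq≡0 , s≡ ← ∷-injective (unfolded e) =
      sym s≡ , ≤∧≢⇒< f<k (f-long ∘ f-last)
      where
      f<k : f < k
      f<k = m/n≡0⇒m<n (m*n≡0⇒m≡0 (f / k) k (trans (*-comm (f / k) k) kq≡0))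

      f-last : suc f ≡ k → f % k ≡ k ∸ 1
      f-last sf≡k = trans (m<n⇒m%n≡m f<k) (cong (_∸ 1) sf≡k)

  φ-split : ∀ w u {s} → Aligned s → φ k w ≡ u ++ s →
            ∃[ w₁ ] ∃[ w₂ ] w ≡ w₁ ++ w₂ × φ k w₁ ≡ u × φ k w₂ ≡ s
  φ-split w       []      _         eq = [] , w , refl , refl , eq
  φ-split []      (_ ∷ _) _         ()
  φ-split (m ∷ w) (x ∷ u) {s} s-aligned eq with shape m
  ... | short _ e
      with x≡ , eq' ← ∷-injective (trans (cong (_++ φ k w) (sym (φ-letter-init e))) eq)
      with w₁ , w₂ , refl , φw₁ , φw₂ ← φ-split w u s-aligned eq' =
    m ∷ w₁ , w₂ , refl , trans (cong (_++ φ k w₁) (φ-letter-init e)) (cong₂ _∷_ x≡ φw₁) , φw₂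
  ... | long m-long e
      with x≡ , eq' ← ∷-injective (trans (cong (_++ φ k w) (sym (φ-letter-init e))) eq) =
    after-block-start u eq'
    where
    after-block-start : ∀ u → suc m ∷ φ k w ≡ u ++ s →
                        ∃[ w₁ ] ∃[ w₂ ] m ∷ w ≡ w₁ ++ w₂ × φ k w₁ ≡ x ∷ u × φ k w₂ ≡ s
    after-block-start [] eq' = ⊥-elim (long⇒suc%k≢0 m-long (subst Aligned (sym eq') s-aligned))
    after-block-start (y ∷ u) eq'
      with y≡ , eq'' ← ∷-injective eq'
      with w₁ , w₂ , refl , φw₁ , φw₂ ← φ-split w u s-aligned eq'' =
      m ∷ w₁ , w₂ , refl ,
      trans (cong (_++ φ k w₁) (φ-letter-init e)) (cong₂ _∷_ x≡ (cong₂ _∷_ y≡ φw₁)) , φw₂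

  φ-last-letter : ∀ w u {c} → φ k w ≡ u ++ [ c ] → ∃[ w' ] ∃[ d ] w ≡ w' ++ [ d ] × c ≡ suc d
  φ-last-letter w u {c} eq with reverseView w
  ... | [] with () ← ++-conicalʳ u [ c ] (sym eq)
  ... | w' ∶ _ ∶ʳ d = w' , d , refl , sym (proj₂ (∷ʳ-injective _ u (trans (sym φ-snoc) eq)))
    where
    φ-snoc : φ k (w' ++ [ d ]) ≡ (φ k w' ++ φ-init d) ++ [ suc d ]
    φ-snoc = begin
      φ k (w' ++ [ d ])                  ≡⟨ φ-++ w' [ d ] ⟩
      φ k w' ++ φ-letter k d ++ []       ≡⟨ cong (φ k w' ++_) (++-identityʳ _) ⟩
      φ k w' ++ φ-letter k d             ≡⟨ cong (φ k w' ++_) (φ-letter≡ d) ⟩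
      φ k w' ++ φ-init d ++ [ suc d ]    ≡⟨ ++-assoc (φ k w') (φ-init d) _ ⟨
      (φ k w' ++ φ-init d) ++ [ suc d ]  ∎
      where open ≡-Reasoning

  factor-preimage : ∀ {c x a s w} → a % k ≡ 0 → IsFactor (c ∷ φ k x ++ a ∷ s) (φ k w) →
                    ∃[ d ] c ≡ suc d ×
                    ∃[ t ] ∃[ v ] φ k t ≡ a ∷ s ++ v × IsFactor (d ∷ x ++ t) w
  factor-preimage {c} {x} {a} {s} {w} a-aligned (u , v , eq)
    with eq' ← trans eq (trans (cong (λ z → u ++ c ∷ z) (++-assoc (φ k x) (a ∷ s) v))
                               (sym (∷ʳ-++ u c _)))
    with w₁ , w₂ , refl , φw₁ , φw₂ ← φ-split w (u ++ [ c ]) (φ-++-aligned x a-aligned) eq'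
    with w₀ , d , refl , refl ← φ-last-letter w₁ u φw₁
    with x' , t , refl , φx' , φt ← φ-split w₂ (φ k x) a-aligned φw₂
    with refl ← φ-injective x' x φx' =
    d , refl , t , v , φt ,
    w₀ , [] , trans (∷ʳ-++ w₀ d (x ++ t)) (cong (w₀ ++_) (sym (++-identityʳ _)))

  W-init : ℕ → Word
  W-init zero    = []
  W-init (suc l) = φ k (W-init l) ++ φ-init l

  W-suc : ∀ l → W k (suc l) ≡ φ k (W-init l) ++ φ-letter k l
  W≡W-init∷ʳ : ∀ l → W k l ≡ W-init l ++ [ l ]

  W-suc l = begin
    φ k (W k l)                          ≡⟨ cong (φ k) (W≡W-init∷ʳ l) ⟩
    φ k (W-init l ++ [ l ])              ≡⟨ φ-++ (W-init l) [ l ] ⟩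
    φ k (W-init l) ++ φ-letter k l ++ [] ≡⟨ cong (φ k (W-init l) ++_) (++-identityʳ _) ⟩
    φ k (W-init l) ++ φ-letter k l       ∎
    where open ≡-Reasoning

  W≡W-init∷ʳ zero    = refl
  W≡W-init∷ʳ (suc l) = begin
    W k (suc l)                              ≡⟨ W-suc l ⟩
    φ k (W-init l) ++ φ-letter k l           ≡⟨ cong (φ k (W-init l) ++_) (φ-letter≡ l) ⟩
    φ k (W-init l) ++ φ-init l ++ [ suc l ]  ≡⟨ ++-assoc (φ k (W-init l)) (φ-init l) _ ⟨
    W-init (suc l) ++ [ suc l ]              ∎
    where open ≡-Reasoning

  φ-init-small : ∀ {l} → suc l < k → φ-init l ≡ [ 0 ]
  φ-init-small {l} sl<k = by-shape (shape l)
    where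
    l<k : l < k
    l<k = <-trans (n<1+n l) sl<k

    by-shape : Shape l → φ-init l ≡ [ 0 ]
    by-shape (short l-last _) =
      ⊥-elim (<-irrefl (trans (cong suc (trans (sym (m<n⇒m%n≡m l<k)) l-last)) (suc-pred k)) sl<k)
    by-shape (long _ e) = trans e (cong [_] (trans (cong (k *_) (m<n⇒m/n≡0 l<k)) (*-zeroʳ k)))

  W-init-ends-long : 1 < k → ∀ {l} → l % k ≡ k ∸ 1 →
                     ∃[ J ] ∃[ m ] W-init l ≡ J ++ [ m ] × m % k ≢ k ∸ 1
  W-init-ends-long 1<k {zero} 0-last = ⊥-elim (aligned⇒not-last 1<k 0%k≡0 0-last)
  W-init-ends-long 1<k {suc l} sl-last with shape l
  ... | short l-last _ = ⊥-elim (aligned⇒not-last 1<k (last⇒suc%k≡0 l-last) sl-last)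
  ... | long _ e = φ k (W-init l) , k * (l / k) , cong (φ k (W-init l) ++_) e ,
                   aligned⇒not-last 1<k (k*q%k≡0 (l / k))

  Absent : Word → Set
  Absent y = ∀ n → ¬ IsFactor y (W k n)

  Absent-++⁺ˡ : ∀ {x} y → Absent x → Absent (x ++ y)
  Absent-++⁺ˡ {x} y x-absent n (u , v , eq) =
    x-absent n (u , y ++ v , trans eq (cong (u ++_) (++-assoc x y v)))

  Absent-++⁺ʳ : ∀ x {y} → Absent y → Absent (x ++ y)
  Absent-++⁺ʳ x {y} y-absent n (u , v , eq) =
    y-absent n (u ++ x , v , trans eq (trans (cong (u ++_) (++-assoc x y v)) (sym (++-assoc u x (y ++ v)))))

  Absent-∷ʳ-++ : ∀ {d x f} t → Absent (d ∷ x ++ [ f ]) → Absent (d ∷ x ++ f ∷ t)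
  Absent-∷ʳ-++ {d} {x} {f} t = subst Absent (cong (d ∷_) (∷ʳ-++ x f t)) ∘ Absent-++⁺ˡ t

  ¬IsFactor-W₀ : ∀ {c y a z} → ¬ IsFactor (c ∷ y ++ a ∷ z) (W k 0)
  ¬IsFactor-W₀ {y = []}    ([]        , _ , ())
  ¬IsFactor-W₀ {y = _ ∷ _} ([]        , _ , ())
  ¬IsFactor-W₀             (_ ∷ []    , _ , ())
  ¬IsFactor-W₀             (_ ∷ _ ∷ _ , _ , ())

  absent-from-preimages : ∀ {b c x a s} → c ≤ b → a % k ≡ 0 →
    (∀ {d t v} → d < b → φ k t ≡ a ∷ s ++ v → Absent (d ∷ x ++ t)) →
    Absent (c ∷ φ k x ++ a ∷ s)
  absent-from-preimages _ _ _ zero = ¬IsFactor-W₀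
  absent-from-preimages {x = x} c≤b a-aligned preimages-absent (suc n) factor
    with d , refl , t , v , φt , factor' ← factor-preimage {x = x} {w = W k n} a-aligned factor =
    preimages-absent c≤b φt n factor'

  00-absent : Absent (0 ∷ [ 0 ])
  00-absent = absent-from-preimages {b = 0} {x = []} z≤n 0%k≡0 (λ ())

  ∷W-init-∷ʳ-absent : ∀ l → l < k → ∀ {c e} → c ≤ l → e ≤ l → Absent (c ∷ W-init l ++ [ e ])
  ∷W-init-∷ʳ-absent zero    _    z≤n z≤n = 00-absent
  ∷W-init-∷ʳ-absent (suc l) sl<k {c} {e} c≤sl e≤sl =
    subst Absent (cong (c ∷_) unfold) (absent-from-preimages c≤sl 0%k≡0 preimages-absent)
    where
    unfold : φ k (W-init l) ++ 0 ∷ [ e ] ≡ W-init (suc l) ++ [ e ]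
    unfold = trans (cong (λ ι → φ k (W-init l) ++ ι ++ [ e ]) (sym (φ-init-small sl<k)))
                   (sym (++-assoc (φ k (W-init l)) (φ-init l) [ e ]))

    preimages-absent : ∀ {d t v} → d < suc l → φ k t ≡ 0 ∷ [ e ] ++ v →
                       Absent (d ∷ W-init l ++ t)
    preimages-absent {t = t} d<sl φt with f , t' , refl , e∷v≡ , _ ← φ-from-0 t φt =
      Absent-∷ʳ-++ t' (∷W-init-∷ʳ-absent l (<-trans (n<1+n l) sl<k) (s≤s⁻¹ d<sl)
                         (s≤s⁻¹ (subst (_≤ suc l) (∷-injectiveˡ e∷v≡) e≤sl)))

  module _ (1<k : 1 < k) where

    ∷W-init-absent : ∀ l → k ≤ suc l → ∀ {c} → c ≤ l → Absent (c ∷ W-init l)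
    ∷W-init-absent zero    k≤1 _ = ⊥-elim (<⇒≱ 1<k k≤1)
    ∷W-init-absent (suc l) k≤ssl {c} c≤sl with shape l
    ... | short l-last e
        with J , m , W-init≡ , m-long ← W-init-ends-long 1<k l-last =
      subst Absent (cong (c ∷_) (sym unfold))
            (absent-from-preimages c≤sl (k*q%k≡0 (m / k)) preimages-absent)
      where
      unfold : W-init (suc l) ≡ φ k J ++ k * (m / k) ∷ [ suc m ]
      unfold = begin
        φ k (W-init l) ++ φ-init l         ≡⟨ cong (φ k (W-init l) ++_) e ⟩
        φ k (W-init l) ++ []               ≡⟨ ++-identityʳ _ ⟩
        φ k (W-init l)                     ≡⟨ cong (φ k) W-init≡ ⟩
        φ k (J ++ [ m ])                   ≡⟨ φ-++ J [ m ] ⟩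
        φ k J ++ φ-letter k m ++ []        ≡⟨ cong (φ k J ++_) (++-identityʳ _) ⟩
        φ k J ++ φ-letter k m              ≡⟨ cong (φ k J ++_) (φ-letter-long m-long) ⟩
        φ k J ++ k * (m / k) ∷ [ suc m ]   ∎
        where open ≡-Reasoning

      preimages-absent : ∀ {d t v} → d < suc l → φ k t ≡ k * (m / k) ∷ [ suc m ] ++ v →
                         Absent (d ∷ J ++ t)
      preimages-absent {t = t} {v} d<sl φt
        with t' , refl ← φ-long-prefix m-long t (trans φt (cong (_++ v) (sym (φ-letter-long m-long)))) =
        Absent-∷ʳ-++ t' (subst (λ x → Absent (_ ∷ x)) W-init≡
                           (∷W-init-absent l (last⇒k≤suc l-last) (s≤s⁻¹ d<sl)))
    ... | long _ e =
      subst Absent (cong (λ ι → c ∷ φ k (W-init l) ++ ι) (sym e))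
            (absent-from-preimages c≤sl (k*q%k≡0 (l / k)) preimages-absent)
      where
      preimages-absent : ∀ {d t v} → d < suc l → φ k t ≡ k * (l / k) ∷ [] ++ v →
                         Absent (d ∷ W-init l ++ t)
      preimages-absent {t = t} {v} d<sl φt with k ≤? suc l
      ... | yes k≤sl = Absent-++⁺ˡ t (∷W-init-absent l k≤sl (s≤s⁻¹ d<sl))
      ... | no k≰sl
          with b≡0 ← ∷-injectiveˡ (trans (sym e) (φ-init-small (≰⇒> k≰sl)))
          with f , t' , refl , _ , sf<k ← φ-from-0 t (trans φt (cong (_∷ v) b≡0)) =
        Absent-∷ʳ-++ t' (∷W-init-∷ʳ-absent l (<-trans (n<1+n l) (≰⇒> k≰sl)) (s≤s⁻¹ d<sl)
                           (s≤s⁻¹ (s≤s⁻¹ (≤-trans sf<k k≤ssl))))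

    ∷W-absent : ∀ l {c} → c ≤ l → Absent (c ∷ W k l)
    ∷W-absent zero    z≤n = 00-absent
    ∷W-absent (suc l) {c} c≤sl = by-shape (shape l)
      where
      unfold : ∀ {ι} → φ-init l ≡ ι → c ∷ W k (suc l) ≡ c ∷ φ k (W-init l) ++ ι ++ [ suc l ]
      unfold e = cong (c ∷_) (trans (W-suc l) (cong (φ k (W-init l) ++_) (φ-letter-init e)))

      by-shape : Shape l → Absent (c ∷ W k (suc l))
      by-shape (short l-last e) =
        subst Absent (sym (unfold e))
              (absent-from-preimages c≤sl (last⇒suc%k≡0 l-last) λ {_} {t} d<sl _ →
                 Absent-++⁺ˡ t (∷W-init-absent l (last⇒k≤suc l-last) (s≤s⁻¹ d<sl)))
      by-shape (long l-long e) =
        subst Absent (sym (unfold e)) (absent-from-preimages c≤sl (k*q%k≡0 (l / k)) preimages-absent)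
        where
        preimages-absent : ∀ {d t v} → d < suc l → φ k t ≡ k * (l / k) ∷ [ suc l ] ++ v →
                           Absent (d ∷ W-init l ++ t)
        preimages-absent {t = t} {v} d<sl φt
          with t' , refl ← φ-long-prefix l-long t (trans φt (cong (_++ v) (sym (φ-letter-init e)))) =
          Absent-∷ʳ-++ t' (subst (λ x → Absent (_ ∷ x)) (W≡W-init∷ʳ l)
                             (∷W-absent l (s≤s⁻¹ d<sl)))

lemma16 : (k : ℕ) → .{{_ : NonZero k}} → 3 ≤ k → (i n : ℕ) → i < n → k + 1 ≤ n →
    ¬ IsFactor (W k i ++ W k i) (W k n)
lemma16 k 3≤k i n _ _ =
  subst (λ y → ¬ IsFactor y (W k n)) (sym square≡)
        (Absent-++⁺ʳ k (W-init k i) (∷W-absent k 1<k i ≤-refl) n)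
  where
  1<k : 1 < k
  1<k = ≤-trans (s≤s (s≤s z≤n)) 3≤k

  square≡ : W k i ++ W k i ≡ W-init k i ++ i ∷ W k i
  square≡ = trans (cong (_++ W k i) (W≡W-init∷ʳ k i)) (∷ʳ-++ (W-init k i) i (W k i))
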